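{- Let $r$ be a nonnegative integer, let $(x_n)_{n\ge0}$ be a sequence of complex numbers and let $\hat x_n=\sum_{k=0}^n(-1)^k\binom nk x_k$ be its binomial transform. Then for all $n\ge0$, $$\sum_{k=0}^n(-1)^k\binom nk\binom{n+k+2r}{k+r}\hat x_k=(-1)^n\sum_{k=0}^n(-1)^k\binom nk\binom{n+k+2r}{k+r}x_k.$$ -}

module Defs where

open import Level using (Level)
open import Algebra.Bundles using (CommutativeRing)
open import Data.Nat using (ℕ; zero; suc)
open import Data.Nat.Combinatorics using (_C_)

-- Everything is stated over an arbitrary commutative ring R (this includes ℂ).
module Binom {c ℓ : Level} (R : CommutativeRing c ℓ) where
  open CommutativeRing R using (Carrier; _+_; -_; +-rawMonoid)
  open import Algebra.Definitions.RawMonoid +-rawMonoid public using (_×_)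

  signed : ℕ → Carrier → Carrier
  signed zero    a = a
  signed (suc m) a = - signed m a

  sumTo : ℕ → (ℕ → Carrier) → Carrier
  sumTo zero    f = f zero
  sumTo (suc n) f = sumTo n f + f (suc n)

  binomialTransform : (ℕ → Carrier) → ℕ → Carrier
  binomialTransform x n = sumTo n (λ k → signed k ((n C k) × x k))

-- Expanding x̂ₖ = Σⱼ (-1)ʲ C(k,j) xⱼ and exchanging the two sums, it suffices to compare the
-- coefficients of each xⱼ (j ≤ n):
--   Σₖ (-1)ᵏ C(n,k) C(k,j) C(n+k+2r, k+r) = (-1)ⁿ C(n,j) C(n+j+2r, j+r).
-- By C(n,k) C(k,j) = C(n,j) C(n-j, k-j), and writing m = n - j, N = n+j+2r, q = j+r, the
-- left side is (-1)ʲ C(n,j) Σᵢ (-1)ⁱ C(m,i) C(N+i, q+i).  This alternating sum is an m-th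
-- difference, so Pascal's rule and induction on m evaluate it to (-1)ᵐ C(N, q+m); finally
-- C(N, q+m) = C(N, j+r) because (q+m) + (j+r) = N.
module Submission where

open import Defs
open import Level using (Level)
open import Algebra.Bundles using (CommutativeRing)
open import Data.Nat using (ℕ; _+_; _*_)
open import Data.Nat.Combinatorics using (_C_)

open import Data.Nat using (zero; suc; _∸_; _≤_; _<_; _≤?_; z≤n; s≤s; _!; NonZero)
import Data.Nat.Properties as ℕₚ
open import Data.Nat.Properties using (_!≢0; _!*_!≢0)
open import Data.Nat.DivMod using (m/n*n≡m)
open import Data.Nat.Combinatorics using (nCk≡n!/k![n-k]!; k![n∸k]!∣n!; k>n⇒nCk≡0; nCk≡nC[n∸k]; nCk+nC[k+1]≡[n+1]C[k+1])
open import Data.Nat.Tactic.RingSolver using (solve-∀)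
open import Data.Product using (_,_)
open import Relation.Binary.PropositionalEquality as ≡ using (_≡_)
open import Relation.Nullary using (yes; no)

[m+n]Cm*[m!*n!]≡[m+n]! : ∀ m n → ((m + n) C m) * (m ! * n !) ≡ (m + n) !
[m+n]Cm*[m!*n!]≡[m+n]! m n =
  ≡.subst (λ k → ((m + n) C m) * (m ! * k !) ≡ (m + n) !) (ℕₚ.m+n∸m≡n m n) factorial-form
  where
  factorial-form : ((m + n) C m) * (m ! * (m + n ∸ m) !) ≡ (m + n) !
  factorial-form = ≡.trans (≡.cong (_* (m ! * (m + n ∸ m) !)) (nCk≡n!/k![n-k]! (ℕₚ.m≤m+n m n)))
                         (m/n*n≡m {{m !* (m + n ∸ m) !≢0}} (k![n∸k]!∣n! (ℕₚ.m≤m+n m n)))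

[j+[i+l]]C[j+i]*[j+i]Cj≡[j+[i+l]]Cj*[i+l]Ci : ∀ j i l →
  ((j + (i + l)) C (j + i)) * ((j + i) C j) ≡ ((j + (i + l)) C j) * ((i + l) C i)
[j+[i+l]]C[j+i]*[j+i]Cj≡[j+[i+l]]Cj*[i+l]Ci j i l =
  ℕₚ.*-cancelʳ-≡ _ _ (j ! * (i ! * l !)) {{j!i!l!≢0}} (≡.trans lhs-expansion (≡.sym rhs-expansion))
  where
  open ≡.≡-Reasoning
  regroupˡ : ∀ a b u v w → a * b * (u * (v * w)) ≡ a * ((b * (u * v)) * w)
  regroupˡ = solve-∀
  regroupʳ : ∀ a b u v w → a * b * (u * (v * w)) ≡ a * (u * (b * (v * w)))
  regroupʳ = solve-∀
  j!i!l!≢0 : NonZero (j ! * (i ! * l !))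
  j!i!l!≢0 = ℕₚ.m*n≢0 (j !) (i ! * l !) {{j !≢0}} {{i !* l !≢0}}
  lhs-expansion : ((j + (i + l)) C (j + i)) * ((j + i) C j) * (j ! * (i ! * l !)) ≡ (j + (i + l)) !
  lhs-expansion = begin
      ((j + (i + l)) C (j + i)) * ((j + i) C j) * (j ! * (i ! * l !))
    ≡⟨ regroupˡ ((j + (i + l)) C (j + i)) ((j + i) C j) (j !) (i !) (l !) ⟩
      ((j + (i + l)) C (j + i)) * ((((j + i) C j) * (j ! * i !)) * l !)
    ≡⟨ ≡.cong (λ u → ((j + (i + l)) C (j + i)) * (u * l !)) ([m+n]Cm*[m!*n!]≡[m+n]! j i) ⟩
      ((j + (i + l)) C (j + i)) * ((j + i) ! * l !)
    ≡⟨ ≡.subst (λ t → (t C (j + i)) * ((j + i) ! * l !) ≡ t !) (ℕₚ.+-assoc j i l) ([m+n]Cm*[m!*n!]≡[m+n]! (j + i) l) ⟩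
      (j + (i + l)) !
    ∎
  rhs-expansion : ((j + (i + l)) C j) * ((i + l) C i) * (j ! * (i ! * l !)) ≡ (j + (i + l)) !
  rhs-expansion = begin
      ((j + (i + l)) C j) * ((i + l) C i) * (j ! * (i ! * l !))
    ≡⟨ regroupʳ ((j + (i + l)) C j) ((i + l) C i) (j !) (i !) (l !) ⟩
      ((j + (i + l)) C j) * (j ! * (((i + l) C i) * (i ! * l !)))
    ≡⟨ ≡.cong (λ u → ((j + (i + l)) C j) * (j ! * u)) ([m+n]Cm*[m!*n!]≡[m+n]! i l) ⟩
      ((j + (i + l)) C j) * (j ! * (i + l) !)
    ≡⟨ [m+n]Cm*[m!*n!]≡[m+n]! j (i + l) ⟩
      (j + (i + l)) !
    ∎

[j+m]C[j+i]*[j+i]Cj≡[j+m]Cj*mCi : ∀ j m i →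
  ((j + m) C (j + i)) * ((j + i) C j) ≡ ((j + m) C j) * (m C i)
[j+m]C[j+i]*[j+i]Cj≡[j+m]Cj*mCi j m i with i ≤? m
... | no i≰m = begin
    ((j + m) C (j + i)) * ((j + i) C j) ≡⟨ ≡.cong (_* ((j + i) C j)) (k>n⇒nCk≡0 (ℕₚ.+-monoʳ-< j m<i)) ⟩
    0                                   ≡⟨ ℕₚ.*-zeroʳ ((j + m) C j) ⟨
    ((j + m) C j) * 0                   ≡⟨ ≡.cong (((j + m) C j) *_) (k>n⇒nCk≡0 m<i) ⟨
    ((j + m) C j) * (m C i)             ∎
  where
  open ≡.≡-Reasoning
  m<i = ℕₚ.≰⇒> i≰m
... | yes i≤m with ℕₚ.m≤n⇒∃[o]m+o≡n i≤m
...   | l , ≡.refl = [j+[i+l]]C[j+i]*[j+i]Cj≡[j+[i+l]]Cj*[i+l]Ci j i l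

[m+n]Cm≡[m+n]Cn : ∀ m n → (m + n) C m ≡ (m + n) C n
[m+n]Cm≡[m+n]Cn m n =
  ≡.trans (nCk≡nC[n∸k] (ℕₚ.m≤m+n m n)) (≡.cong ((m + n) C_) (ℕₚ.m+n∸m≡n m n))

weight : ℕ → ℕ → ℕ → ℕ
weight r n k = (n + k + 2 * r) C (k + r)

module BinomialTransformProperties {c ℓ : Level} (R : CommutativeRing c ℓ) where
  open CommutativeRing R
    using (Carrier; _≈_; 0#; -_; +-cong; -‿cong; +-assoc; +-identityˡ; +-identityʳ;
           refl; sym; trans; reflexive; setoid;
           +-monoid; +-commutativeMonoid; +-group; +-abelianGroup; +-commutativeSemigroup)
    renaming (_+_ to _⊕_; +-comm to ⊕-comm)
  open Binom R
  open import Relation.Binary.Reasoning.Setoid setoid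
  open import Algebra.Properties.Monoid.Mult +-monoid using (×-congʳ; ×-congˡ; ×-homo-1; ×-homo-+; ×-assocˡ)
  open import Algebra.Properties.CommutativeMonoid.Mult +-commutativeMonoid using (×-distrib-+)
  open import Algebra.Properties.AbelianGroup +-abelianGroup using (⁻¹-∙-comm; ⁻¹-anti-homo‿-; xyx⁻¹≈y)
  open import Algebra.Properties.Group +-group using (ε⁻¹≈ε)
  open import Algebra.Properties.CommutativeSemigroup +-commutativeSemigroup using (interchange)

  neg-distrib-⊕ : ∀ a b → - (a ⊕ b) ≈ - a ⊕ - b
  neg-distrib-⊕ a b = sym (⁻¹-∙-comm a b)

  a⊕-[a⊕b]≈-b : ∀ a b → a ⊕ - (a ⊕ b) ≈ - b
  a⊕-[a⊕b]≈-b a b = trans (sym (⁻¹-anti-homo‿- (a ⊕ b) a)) (-‿cong (xyx⁻¹≈y a b))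

  ×-zeroʳ : ∀ n → n × 0# ≈ 0#
  ×-zeroʳ zero    = refl
  ×-zeroʳ (suc n) = trans (+-identityˡ _) (×-zeroʳ n)

  ×-neg : ∀ n a → n × (- a) ≈ - (n × a)
  ×-neg zero    a = sym ε⁻¹≈ε
  ×-neg (suc n) a = trans (+-cong refl (×-neg n a)) (sym (neg-distrib-⊕ a (n × a)))

  ×-comm : ∀ m n a → m × (n × a) ≈ n × (m × a)
  ×-comm m n a = begin
    m × (n × a)   ≈⟨ ×-assocˡ a m n ⟩
    (m * n) × a   ≡⟨ ≡.cong (_× a) (ℕₚ.*-comm m n) ⟩
    (n * m) × a   ≈⟨ ×-assocˡ a n m ⟨
    n × (m × a)   ∎

  signed-cong : ∀ m {a b} → a ≈ b → signed m a ≈ signed m b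
  signed-cong zero    a≈b = a≈b
  signed-cong (suc m) a≈b = -‿cong (signed-cong m a≈b)

  signed-zero : ∀ m → signed m 0# ≈ 0#
  signed-zero zero    = refl
  signed-zero (suc m) = trans (-‿cong (signed-zero m)) ε⁻¹≈ε

  signed-distrib-⊕ : ∀ m a b → signed m (a ⊕ b) ≈ signed m a ⊕ signed m b
  signed-distrib-⊕ zero    a b = refl
  signed-distrib-⊕ (suc m) a b = trans (-‿cong (signed-distrib-⊕ m a b)) (neg-distrib-⊕ _ _)

  signed-homo-+ : ∀ m k a → signed (m + k) a ≡ signed m (signed k a)
  signed-homo-+ zero    k a = ≡.refl
  signed-homo-+ (suc m) k a = ≡.cong -_ (signed-homo-+ m k a)

  signed-comm : ∀ m k a → signed m (signed k a) ≡ signed k (signed m a)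
  signed-comm m k a = ≡.trans (≡.sym (signed-homo-+ m k a))
    (≡.trans (≡.cong (λ e → signed e a) (ℕₚ.+-comm m k)) (signed-homo-+ k m a))

  ×-signed : ∀ n m a → n × signed m a ≈ signed m (n × a)
  ×-signed n zero    a = refl
  ×-signed n (suc m) a = trans (×-neg n _) (-‿cong (×-signed n m a))

  sumTo-cong : ∀ n {f g} → (∀ k → k ≤ n → f k ≈ g k) → sumTo n f ≈ sumTo n g
  sumTo-cong zero    f≈g = f≈g zero z≤n
  sumTo-cong (suc n) f≈g =
    +-cong (sumTo-cong n (λ k k≤n → f≈g k (ℕₚ.m≤n⇒m≤1+n k≤n))) (f≈g (suc n) ℕₚ.≤-refl)

  sumTo-distrib-⊕ : ∀ n f g → sumTo n (λ k → f k ⊕ g k) ≈ sumTo n f ⊕ sumTo n g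
  sumTo-distrib-⊕ zero    f g = refl
  sumTo-distrib-⊕ (suc n) f g = trans (+-cong (sumTo-distrib-⊕ n f g) refl) (interchange _ _ _ _)

  sumTo-homo : ∀ (φ : Carrier → Carrier) → (∀ {a b} → a ≈ b → φ a ≈ φ b) →
               (∀ a b → φ (a ⊕ b) ≈ φ a ⊕ φ b) →
               ∀ n f → sumTo n (λ k → φ (f k)) ≈ φ (sumTo n f)
  sumTo-homo φ φ-cong φ-⊕ zero    f = refl
  sumTo-homo φ φ-cong φ-⊕ (suc n) f = trans (+-cong (sumTo-homo φ φ-cong φ-⊕ n f) refl) (sym (φ-⊕ _ _))

  sumTo-neg : ∀ n f → sumTo n (λ k → - f k) ≈ - sumTo n f
  sumTo-neg = sumTo-homo -_ -‿cong neg-distrib-⊕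

  sumTo-× : ∀ m n f → sumTo n (λ k → m × f k) ≈ m × sumTo n f
  sumTo-× m = sumTo-homo (m ×_) (×-congʳ m) (λ a b → ×-distrib-+ a b m)

  sumTo-signed : ∀ m n f → sumTo n (λ k → signed m (f k)) ≈ signed m (sumTo n f)
  sumTo-signed m = sumTo-homo (signed m) (signed-cong m) (signed-distrib-⊕ m)

  sumTo-comm : ∀ n m (g : ℕ → ℕ → Carrier) →
               sumTo n (λ k → sumTo m (g k)) ≈ sumTo m (λ j → sumTo n (λ k → g k j))
  sumTo-comm zero    m g = refl
  sumTo-comm (suc n) m g = trans (+-cong (sumTo-comm n m g) refl)
    (sym (sumTo-distrib-⊕ m (λ j → sumTo n (λ k → g k j)) (g (suc n))))

  sumTo-head : ∀ n f → sumTo (suc n) f ≈ f 0 ⊕ sumTo n (λ i → f (suc i))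
  sumTo-head zero    f = refl
  sumTo-head (suc n) f = trans (+-cong (sumTo-head n f) refl) (+-assoc _ _ _)

  sumTo-zero : ∀ n f → (∀ k → k ≤ n → f k ≈ 0#) → sumTo n f ≈ 0#
  sumTo-zero zero    f f≈0 = f≈0 zero z≤n
  sumTo-zero (suc n) f f≈0 =
    trans (+-cong (sumTo-zero n f (λ k k≤n → f≈0 k (ℕₚ.m≤n⇒m≤1+n k≤n))) (f≈0 (suc n) ℕₚ.≤-refl)) (+-identityʳ 0#)

  sumTo-lastOnly : ∀ j f → (∀ k → k < j → f k ≈ 0#) → sumTo j f ≈ f j
  sumTo-lastOnly zero    f f≈0 = refl
  sumTo-lastOnly (suc j) f f≈0 =
    trans (+-cong (sumTo-zero j f (λ k k≤j → f≈0 k (s≤s k≤j))) refl) (+-identityˡ _)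

  sumTo-dropInitial : ∀ j m f → (∀ k → k < j → f k ≈ 0#) → sumTo (j + m) f ≈ sumTo m (λ i → f (j + i))
  sumTo-dropInitial j zero f f≈0 rewrite ℕₚ.+-identityʳ j = sumTo-lastOnly j f f≈0
  sumTo-dropInitial j (suc m) f f≈0 rewrite ℕₚ.+-suc j m = +-cong (sumTo-dropInitial j m f f≈0) refl

  sumTo-extend : ∀ {k n} f → k ≤ n → (∀ i → k < i → f i ≈ 0#) → sumTo k f ≈ sumTo n f
  sumTo-extend {k} f k≤n f≈0 with ℕₚ.m≤n⇒∃[o]m+o≡n k≤n
  ... | d , ≡.refl = extendBy d
    where
    extendBy : ∀ d → sumTo k f ≈ sumTo (k + d) f
    extendBy zero    rewrite ℕₚ.+-identityʳ k = refl
    extendBy (suc d) rewrite ℕₚ.+-suc k d =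
      trans (extendBy d) (sym (trans (+-cong refl (f≈0 _ (s≤s (ℕₚ.m≤m+n k d)))) (+-identityʳ _)))

  binomialTransform-cong : ∀ {t u} m → (∀ k → t k ≈ u k) → binomialTransform t m ≈ binomialTransform u m
  binomialTransform-cong m t≈u = sumTo-cong m (λ k _ → signed-cong k (×-congʳ (m C k) (t≈u k)))

  binomialTransform-suc : ∀ t m →
    binomialTransform t (suc m) ≈ binomialTransform t m ⊕ - binomialTransform (λ i → t (suc i)) m
  binomialTransform-suc t m = begin
      sumTo (suc m) f
    ≈⟨ sumTo-head m f ⟩
      g 0 ⊕ sumTo m (λ i → f (suc i))
    ≈⟨ +-cong refl (sumTo-cong m (λ i _ → pascal-step i)) ⟩
      g 0 ⊕ sumTo m (λ i → g (suc i) ⊕ - h i)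
    ≈⟨ +-cong refl (sumTo-distrib-⊕ m (λ i → g (suc i)) (λ i → - h i)) ⟩
      g 0 ⊕ (sumTo m (λ i → g (suc i)) ⊕ sumTo m (λ i → - h i))
    ≈⟨ +-assoc _ _ _ ⟨
      (g 0 ⊕ sumTo m (λ i → g (suc i))) ⊕ sumTo m (λ i → - h i)
    ≈⟨ +-cong (sym (sumTo-head m g)) (sumTo-neg m h) ⟩
      sumTo (suc m) g ⊕ - sumTo m h
    ≈⟨ +-cong (sumTo-extend g (ℕₚ.n≤1+n m) g-vanishes) refl ⟨
      sumTo m g ⊕ - sumTo m h
    ∎
    where
    f g h : ℕ → Carrier
    f i = signed i ((suc m C i) × t i)
    g i = signed i ((m C i) × t i)
    h i = signed i ((m C i) × t (suc i))
    pascal-step : ∀ i → f (suc i) ≈ g (suc i) ⊕ - h i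
    pascal-step i = begin
        - signed i ((suc m C suc i) × t (suc i))
      ≈⟨ -‿cong (signed-cong i (×-congˡ (≡.sym (nCk+nC[k+1]≡[n+1]C[k+1] m i)))) ⟩
        - signed i ((m C i + m C suc i) × t (suc i))
      ≈⟨ -‿cong (signed-cong i (×-homo-+ (t (suc i)) (m C i) (m C suc i))) ⟩
        - signed i ((m C i) × t (suc i) ⊕ (m C suc i) × t (suc i))
      ≈⟨ -‿cong (signed-distrib-⊕ i _ _) ⟩
        - (h i ⊕ signed i ((m C suc i) × t (suc i)))
      ≈⟨ neg-distrib-⊕ _ _ ⟩
        - h i ⊕ g (suc i)
      ≈⟨ ⊕-comm _ _ ⟩
        g (suc i) ⊕ - h i
      ∎
    g-vanishes : ∀ i → m < i → g i ≈ 0#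
    g-vanishes i m<i = trans (signed-cong i (×-congˡ (k>n⇒nCk≡0 m<i))) (signed-zero i)

  binomialTransform-shiftedBinomial : ∀ N q a m →
    binomialTransform (λ i → ((N + i) C (q + i)) × a) m ≈ signed m ((N C (q + m)) × a)
  binomialTransform-shiftedBinomial N q a zero =
    trans (×-homo-1 _) (reflexive (≡.cong (λ u → (u C (q + 0)) × a) (ℕₚ.+-identityʳ N)))
  binomialTransform-shiftedBinomial N q a (suc m) = begin
      binomialTransform T (suc m)
    ≈⟨ binomialTransform-suc T m ⟩
      binomialTransform T m ⊕ - binomialTransform (λ i → T (suc i)) m
    ≈⟨ +-cong (binomialTransform-shiftedBinomial N q a m) (-‿cong shifted-by-pascal) ⟩
      signed m A ⊕ - (signed m A ⊕ signed m B)
    ≈⟨ a⊕-[a⊕b]≈-b (signed m A) (signed m B) ⟩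
      - signed m B
    ≡⟨ ≡.cong (λ e → - signed m ((N C e) × a)) (ℕₚ.+-suc q m) ⟨
      signed (suc m) ((N C (q + suc m)) × a)
    ∎
    where
    T : ℕ → Carrier
    T i = ((N + i) C (q + i)) × a
    A = (N C (q + m)) × a
    B = (N C suc (q + m)) × a
    shifted-by-pascal : binomialTransform (λ i → T (suc i)) m ≈ signed m A ⊕ signed m B
    shifted-by-pascal = begin
        binomialTransform (λ i → T (suc i)) m
      ≈⟨ binomialTransform-cong m (λ i → reflexive (≡.cong₂ (λ u v → (u C v) × a) (ℕₚ.+-suc N i) (ℕₚ.+-suc q i))) ⟩
        binomialTransform (λ i → ((suc N + i) C (suc q + i)) × a) m
      ≈⟨ binomialTransform-shiftedBinomial (suc N) (suc q) a m ⟩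
        signed m ((suc N C suc (q + m)) × a)
      ≈⟨ signed-cong m (×-congˡ (≡.sym (nCk+nC[k+1]≡[n+1]C[k+1] N (q + m)))) ⟩
        signed m ((N C (q + m) + N C suc (q + m)) × a)
      ≈⟨ signed-cong m (×-homo-+ a (N C (q + m)) (N C suc (q + m))) ⟩
        signed m (A ⊕ B)
      ≈⟨ signed-distrib-⊕ m A B ⟩
        signed m A ⊕ signed m B
      ∎

  binomialTransform-choose : ∀ j m (w : ℕ → Carrier) →
    binomialTransform (λ k → (k C j) × w k) (j + m)
      ≈ signed j (((j + m) C j) × binomialTransform (λ i → w (j + i)) m)
  binomialTransform-choose j m w = begin
      sumTo (j + m) F
    ≈⟨ sumTo-dropInitial j m F F-vanishes ⟩
      sumTo m (λ i → F (j + i))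
    ≈⟨ sumTo-cong m (λ i _ → revision i) ⟩
      sumTo m (λ i → signed j (D × signed i ((m C i) × w (j + i))))
    ≈⟨ sumTo-signed j m _ ⟩
      signed j (sumTo m (λ i → D × signed i ((m C i) × w (j + i))))
    ≈⟨ signed-cong j (sumTo-× D m _) ⟩
      signed j (D × binomialTransform (λ i → w (j + i)) m)
    ∎
    where
    D = (j + m) C j
    F : ℕ → Carrier
    F k = signed k (((j + m) C k) × ((k C j) × w k))
    F-vanishes : ∀ k → k < j → F k ≈ 0#
    F-vanishes k k<j = begin
      F k                                           ≈⟨ signed-cong k (×-congʳ ((j + m) C k) (×-congˡ (k>n⇒nCk≡0 k<j))) ⟩
      signed k (((j + m) C k) × 0#)                 ≈⟨ signed-cong k (×-zeroʳ ((j + m) C k)) ⟩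
      signed k 0#                                   ≈⟨ signed-zero k ⟩
      0#                                            ∎
    revision : ∀ i → F (j + i) ≈ signed j (D × signed i ((m C i) × w (j + i)))
    revision i = begin
        signed (j + i) (((j + m) C (j + i)) × (((j + i) C j) × w (j + i)))
      ≈⟨ signed-cong (j + i) (×-assocˡ _ ((j + m) C (j + i)) ((j + i) C j)) ⟩
        signed (j + i) ((((j + m) C (j + i)) * ((j + i) C j)) × w (j + i))
      ≡⟨ ≡.cong (λ e → signed (j + i) (e × w (j + i))) ([j+m]C[j+i]*[j+i]Cj≡[j+m]Cj*mCi j m i) ⟩
        signed (j + i) ((D * (m C i)) × w (j + i))
      ≈⟨ signed-cong (j + i) (×-assocˡ _ D (m C i)) ⟨
        signed (j + i) (D × ((m C i) × w (j + i)))
      ≡⟨ signed-homo-+ j i _ ⟩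
        signed j (signed i (D × ((m C i) × w (j + i))))
      ≈⟨ signed-cong j (×-signed D i _) ⟨
        signed j (D × signed i ((m C i) × w (j + i)))
      ∎

  binomialTransform-interchange : ∀ (w : ℕ → ℕ) x n →
    binomialTransform (λ k → w k × binomialTransform x k) n
      ≈ sumTo n (λ j → signed j (binomialTransform (λ k → (k C j) × (w k × x j)) n))
  binomialTransform-interchange w x n = begin
      sumTo n (λ k → signed k ((n C k) × (w k × sumTo k (h k))))
    ≈⟨ sumTo-cong n (λ k k≤n → signed-cong k (×-congʳ (n C k) (×-congʳ (w k) (sumTo-extend (h k) k≤n (h-vanishes k))))) ⟩
      sumTo n (λ k → signed k ((n C k) × (w k × sumTo n (h k))))
    ≈⟨ sumTo-cong n (λ k _ → sym (scalars-inside k)) ⟩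
      sumTo n (λ k → sumTo n (λ j → signed k ((n C k) × (w k × h k j))))
    ≈⟨ sumTo-comm n n _ ⟩
      sumTo n (λ j → sumTo n (λ k → signed k ((n C k) × (w k × h k j))))
    ≈⟨ sumTo-cong n (λ j _ → sumTo-cong n (λ k _ → regroup k j)) ⟩
      sumTo n (λ j → sumTo n (λ k → signed j (signed k ((n C k) × ((k C j) × (w k × x j))))))
    ≈⟨ sumTo-cong n (λ j _ → sumTo-signed j n _) ⟩
      sumTo n (λ j → signed j (binomialTransform (λ k → (k C j) × (w k × x j)) n))
    ∎
    where
    h : ℕ → ℕ → Carrier
    h k j = signed j ((k C j) × x j)
    h-vanishes : ∀ k j → k < j → h k j ≈ 0#
    h-vanishes k j k<j = trans (signed-cong j (×-congˡ (k>n⇒nCk≡0 k<j))) (signed-zero j)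
    scalars-inside : ∀ k → sumTo n (λ j → signed k ((n C k) × (w k × h k j)))
                             ≈ signed k ((n C k) × (w k × sumTo n (h k)))
    scalars-inside k = begin
      sumTo n (λ j → signed k ((n C k) × (w k × h k j)))   ≈⟨ sumTo-signed k n _ ⟩
      signed k (sumTo n (λ j → (n C k) × (w k × h k j)))   ≈⟨ signed-cong k (sumTo-× (n C k) n _) ⟩
      signed k ((n C k) × sumTo n (λ j → w k × h k j))     ≈⟨ signed-cong k (×-congʳ (n C k) (sumTo-× (w k) n _)) ⟩
      signed k ((n C k) × (w k × sumTo n (h k)))           ∎
    regroup : ∀ k j → signed k ((n C k) × (w k × h k j))
                        ≈ signed j (signed k ((n C k) × ((k C j) × (w k × x j))))
    regroup k j = begin
        signed k ((n C k) × (w k × signed j ((k C j) × x j)))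
      ≈⟨ signed-cong k (×-congʳ (n C k) (×-signed (w k) j _)) ⟩
        signed k ((n C k) × signed j (w k × ((k C j) × x j)))
      ≈⟨ signed-cong k (×-signed (n C k) j _) ⟩
        signed k (signed j ((n C k) × (w k × ((k C j) × x j))))
      ≡⟨ signed-comm k j _ ⟩
        signed j (signed k ((n C k) × (w k × ((k C j) × x j))))
      ≈⟨ signed-cong j (signed-cong k (×-congʳ (n C k) (×-comm (w k) (k C j) (x j)))) ⟩
        signed j (signed k ((n C k) × ((k C j) × (w k × x j))))
      ∎

  binomialTransform-column : ∀ r {j n} → j ≤ n → ∀ a →
    binomialTransform (λ k → (k C j) × (weight r n k × a)) n
      ≈ signed n ((n C j) × (weight r n j × a))
  binomialTransform-column r {j} j≤n a with ℕₚ.m≤n⇒∃[o]m+o≡n j≤n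
  ... | m , ≡.refl = begin
      binomialTransform (λ k → (k C j) × (weight r n k × a)) n
    ≈⟨ binomialTransform-choose j m _ ⟩
      signed j (D × binomialTransform (λ i → weight r n (j + i) × a) m)
    ≈⟨ signed-cong j (×-congʳ D (binomialTransform-cong m (λ i → reflexive (≡.cong₂ (λ u v → (u C v) × a) (top i) (bottom i))))) ⟩
      signed j (D × binomialTransform (λ i → ((N + i) C (q + i)) × a) m)
    ≈⟨ signed-cong j (×-congʳ D (binomialTransform-shiftedBinomial N q a m)) ⟩
      signed j (D × signed m ((N C (q + m)) × a))
    ≡⟨ ≡.cong (λ e → signed j (D × signed m (e × a))) symmetry ⟩
      signed j (D × signed m (weight r n j × a))
    ≈⟨ signed-cong j (×-signed D m _) ⟩
      signed j (signed m (D × (weight r n j × a)))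
    ≡⟨ signed-homo-+ j m _ ⟨
      signed n (D × (weight r n j × a))
    ∎
    where
    n = j + m
    N = n + j + 2 * r
    q = j + r
    D = n C j
    top : ∀ i → n + (j + i) + 2 * r ≡ N + i
    top i = top-identity j m i r
      where
      top-identity : ∀ j m i r → j + m + (j + i) + 2 * r ≡ j + m + j + 2 * r + i
      top-identity = solve-∀
    bottom : ∀ i → j + i + r ≡ q + i
    bottom i = bottom-identity j i r
      where
      bottom-identity : ∀ j i r → j + i + r ≡ j + r + i
      bottom-identity = solve-∀
    symmetry : N C (q + m) ≡ N C (j + r)
    symmetry = ≡.subst (λ t → t C (q + m) ≡ t C (j + r)) (≡.sym (split j m r)) ([m+n]Cm≡[m+n]Cn (q + m) (j + r))
      where
      split : ∀ j m r → j + m + j + 2 * r ≡ (j + r + m) + (j + r)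
      split = solve-∀

mainTheorem4 : ∀ {c ℓ : Level} (R : CommutativeRing c ℓ) →
    let open Binom R in
    (r : ℕ) (x : ℕ → CommutativeRing.Carrier R) (n : ℕ) →
    CommutativeRing._≈_ R
      (sumTo n (λ k → signed k ((n C k) × (((n + k + 2 * r) C (k + r)) × binomialTransform x k))))
      (signed n (sumTo n (λ k → signed k ((n C k) × (((n + k + 2 * r) C (k + r)) × x k)))))
mainTheorem4 R r x n = begin
    binomialTransform (λ k → weight r n k × binomialTransform x k) n
  ≈⟨ binomialTransform-interchange (weight r n) x n ⟩
    sumTo n (λ j → signed j (binomialTransform (λ k → (k C j) × (weight r n k × x j)) n))
  ≈⟨ sumTo-cong n (λ j j≤n → signed-cong j (binomialTransform-column r j≤n (x j))) ⟩
    sumTo n (λ j → signed j (signed n ((n C j) × (weight r n j × x j))))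
  ≈⟨ sumTo-cong n (λ j _ → reflexive (signed-comm j n _)) ⟩
    sumTo n (λ j → signed n (signed j ((n C j) × (weight r n j × x j))))
  ≈⟨ sumTo-signed n n _ ⟩
    signed n (binomialTransform (λ k → weight r n k × x k) n)
  ∎
  where
  open CommutativeRing R using (reflexive; setoid)
  open Binom R
  open BinomialTransformProperties R
  open import Relation.Binary.Reasoning.Setoid setoid
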